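{- For processes with fusions $(P,e),(Q,f)$: $\Phi*_1(P,e)*_1(Q,f)\equiv_\alpha(P,e)\,|\,(Q,f)$ (with $*_1$ associating to the left).
   Context: $\pi$-processes: $P::=\mathbf 0\mid P|Q\mid u^\varepsilon(\vec x).P\mid(\nu x)P$ ($\mathbf 0$ inactive); a fusion is an equivalence relation on names $\mathbb N$ with finite classes; $ef$ denotes the transitive closure of $e\cup f$ and $\prod$ the join of fusions; a process with fusions (PWF) is $(P,e)$, with $(P,e)|(Q,f):=(P|Q,ef)$, and a process $P$ is identified with $(P,\Delta_\mathbb N)$, a fusion $e$ with $(\mathbf 0,e)$. Fix $\iota_1(n)=2n+1$, $\iota_2(n)=2n$, $\mathbb N^i:=\iota_i(\mathbb N)$, $n.i:=\iota_i(n)$, and $n.i.j:=\iota_j(\iota_i(n))$; $(P,e)^i$ renames all names by $\iota_i$ and $(P,e)^{ -i}$ by $\iota_i^{ -1}$ (when all free names lie in $\mathbb N^i$). $(\nu_i)$ denotes the restriction $(\nu\mathbb N^i)$ of the infinite set $\mathbb N^i$: it replaces the (finitely many) free names of the process part lying in $\mathbb N^i$, hereditarily through the fusion, by fused representatives outside $\mathbb N^i$ (binding those that have none), and restricts the fusion to $e\setminus\mathbb N^i$. Define $(P,e)*_1(Q,f):=\big((\nu_1)((P,e)|(Q,f)^1)\big)^{ -2}$ and the fusion $\Phi:=\prod_{n\in\mathbb N}(n.1\leftrightarrow n.1.2)\prod_{n\in\mathbb N}(n.1.2\leftrightarrow n.2.2)$. -}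

module Defs where

open import Level using (0ℓ)
open import Data.Nat using (ℕ; zero; suc; _+_; _*_)
open import Data.Fin using (Fin; _↑ˡ_; _↑ʳ_; splitAt)
open import Data.Sum using (_⊎_; inj₁; inj₂)
open import Data.Product using (Σ; ∃; ∃₂; _×_; _,_; proj₁; proj₂)
open import Data.List using (List)
open import Data.List.Membership.Propositional using (_∈_)
open import Relation.Binary using (Rel; IsEquivalence)
open import Relation.Binary.PropositionalEquality using (_≡_)
open import Relation.Binary.Construct.Closure.Transitive using (TransClosure)
open import Relation.Nullary using (¬_)
open import Function.Bundles using (_⇔_)

-- Processes are represented up to renaming
-- of BOUND names (well-scoped de Bruijn indices for bound names, global
-- natural numbers for free names), so alpha-conversion of bound names is
-- built into the syntax.

data Pol : Set where
  out inp : Pol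

data Name (n : ℕ) : Set where
  fr : ℕ → Name n
  bd : Fin n → Name n

-- P ::= 0 | P|Q | u^ε(x₁…x_k).P | (νx)P ; the prefix binds x₁…x_k in P
data Proc (n : ℕ) : Set where
  𝟎   : Proc n
  _∣_ : Proc n → Proc n → Proc n
  pre : Pol → Name n → (k : ℕ) → Proc (k + n) → Proc n
  ν   : Proc (suc n) → Proc n

shift : ∀ {m} (k : ℕ) → Name m → Name (k + m)
shift k (fr a) = fr a
shift k (bd j) = bd (k ↑ʳ j)

liftN : ∀ {n m} (k : ℕ) → (Name n → Name m) → Name (k + n) → Name (k + m)
liftN k ρ (fr a) = shift k (ρ (fr a))
liftN {n} {m} k ρ (bd i) with splitAt k {n} i
... | inj₁ j = bd (j ↑ˡ m)
... | inj₂ j = shift k (ρ (bd j))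

mapN : ∀ {n m} → (Name n → Name m) → Proc n → Proc m
mapN ρ 𝟎 = 𝟎
mapN ρ (P ∣ Q) = mapN ρ P ∣ mapN ρ Q
mapN ρ (pre ε u k P) = pre ε (ρ u) k (mapN (liftN k ρ) P)
mapN ρ (ν P) = ν (mapN (liftN 1 ρ) P)

renName : ∀ {n} → (ℕ → ℕ) → Name n → Name n
renName σ (fr a) = fr (σ a)
renName σ (bd j) = bd j

ren : ∀ {n} → (ℕ → ℕ) → Proc n → Proc n
ren σ = mapN (renName σ)

data FreeIn (a : ℕ) : ∀ {n} → Proc n → Set where
  par-l : ∀ {n} {P Q : Proc n} → FreeIn a P → FreeIn a (P ∣ Q)
  par-r : ∀ {n} {P Q : Proc n} → FreeIn a Q → FreeIn a (P ∣ Q)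
  subj  : ∀ {n ε k} {P : Proc (k + n)} → FreeIn a (pre ε (fr a) k P)
  body  : ∀ {n ε u k} {P : Proc (k + n)} → FreeIn a P → FreeIn a (pre ε u k P)
  res   : ∀ {n} {P : Proc (suc n)} → FreeIn a P → FreeIn a (ν P)

record IsFusion (e : Rel ℕ 0ℓ) : Set where
  field
    isEquivalence : IsEquivalence e
    finiteClasses : ∀ a → Σ (List ℕ) λ xs → ∀ b → e a b → b ∈ xs

Δ : Rel ℕ 0ℓ
Δ = _≡_

_·_ : Rel ℕ 0ℓ → Rel ℕ 0ℓ → Rel ℕ 0ℓ
e · f = TransClosure (λ a b → e a b ⊎ f a b)

⋁ : {I : Set} → (I → Rel ℕ 0ℓ) → Rel ℕ 0ℓ
⋁ {I} e = TransClosure (λ a b → Σ I λ i → e i a b)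

⟨_↔_⟩ : ℕ → ℕ → Rel ℕ 0ℓ
⟨ a ↔ b ⟩ x y = x ≡ y ⊎ (x ≡ a × y ≡ b) ⊎ (x ≡ b × y ≡ a)

data Side : Set where
  one two : Side

ι : Side → ℕ → ℕ
ι one n = suc (2 * n)
ι two n = 2 * n

InN : Side → ℕ → Set
InN i x = Σ ℕ λ n → ι i n ≡ x

Φ : Rel ℕ 0ℓ
Φ = (⋁ λ n → ⟨ ι one n ↔ ι two (ι one n) ⟩) · (⋁ λ n → ⟨ ι two (ι one n) ↔ ι two (ι two n) ⟩)

PWF : Set₁
PWF = Proc 0 × Rel ℕ 0ℓ

_∥_ : PWF → PWF → PWF
(P , e) ∥ (Q , f) = (P ∣ Q , e · f)

proc : Proc 0 → PWF
proc P = (P , Δ)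

fus : Rel ℕ 0ℓ → PWF
fus e = (𝟎 , e)

img : Side → Rel ℕ 0ℓ → Rel ℕ 0ℓ
img i e x y = x ≡ y ⊎ ∃₂ λ a b → x ≡ ι i a × y ≡ ι i b × e a b

_^_ : PWF → Side → PWF
(P , e) ^ i = (ren (ι i) P , img i e)

-- (P , e)^{-i} (a relation: defined iff all free names of P lie in ℕ^i)
Inv : Side → PWF → PWF → Set₁
Inv i (P , e) R = Σ (Proc 0) λ P' → (ren (ι i) P' ≡ P) × (R ≡ (P' , λ x y → e (ι i x) (ι i y)))

restrict : Side → Rel ℕ 0ℓ → Rel ℕ 0ℓ
restrict i e x y = x ≡ y ⊎ (¬ InN i x × ¬ InN i y × e x y)

nus : (k : ℕ) → Proc k → Proc 0
nus zero P = P
nus (suc k) P = nus k (ν P)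

close : ∀ {k} → (ℕ → Name k) → Name 0 → Name k
close τ (fr a) = τ a
close τ (bd ())

-- (ν_i)(P , e) (a relation, since the choice of representatives is free):
-- every free name a ∈ ℕ^i of P is replaced either by an e-fused
-- representative outside ℕ^i, or, if it has none, by a new bound name;
-- fused names without representative get the same new bound name; the
-- k new bound names are all used; the fusion is restricted to ℕ ∖ ℕ^i.
record NuData (i : Side) (e : Rel ℕ 0ℓ) (P : Proc 0) (k : ℕ) (τ : ℕ → Name k) : Set where
  field
    outside : ∀ a → FreeIn a P → ¬ InN i a → τ a ≡ fr a
    repr    : ∀ a b → FreeIn a P → InN i a → τ a ≡ fr b → ¬ InN i b × e a b
    noRepr  : ∀ a j → FreeIn a P → InN i a → τ a ≡ bd j → ∀ b → e a b → InN i b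
    sameBd  : ∀ a a' j j' → FreeIn a P → FreeIn a' P → InN i a → InN i a' →
              τ a ≡ bd j → τ a' ≡ bd j' → (j ≡ j' ⇔ e a a')
    used    : ∀ j → Σ ℕ λ a → FreeIn a P × τ a ≡ bd j

Nu : Side → PWF → PWF → Set₁
Nu i (P , e) R = Σ ℕ λ k → Σ (ℕ → Name k) λ τ →
  NuData i e P k τ × (R ≡ (nus k (mapN (close τ) P) , restrict i e))

Star₁ : PWF → PWF → PWF → Set₁
Star₁ A B C = Σ PWF λ D → Nu one (A ∥ (B ^ one)) D × Inv two D C

-- α-equivalence of processes with fusions: equal fusions, and processes
-- equal up to renaming of bound names (built in), replacing free names by
-- fused ones, and the monoid laws of parallel composition.

data NmRel (e : Rel ℕ 0ℓ) {n : ℕ} : Name n → Name n → Set where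
  fr : ∀ {a b} → e a b → NmRel e (fr a) (fr b)
  bd : ∀ {j} → NmRel e (bd j) (bd j)

data _⊢_≈_ (e : Rel ℕ 0ℓ) : ∀ {n} → Proc n → Proc n → Set where
  𝟎     : ∀ {n} → e ⊢ 𝟎 {n} ≈ 𝟎
  par   : ∀ {n} {P P' Q Q' : Proc n} → e ⊢ P ≈ P' → e ⊢ Q ≈ Q' → e ⊢ (P ∣ Q) ≈ (P' ∣ Q')
  pre   : ∀ {n ε k} {u v : Name n} {P P' : Proc (k + n)} →
          NmRel e u v → e ⊢ P ≈ P' → e ⊢ pre ε u k P ≈ pre ε v k P'
  res   : ∀ {n} {P P' : Proc (suc n)} → e ⊢ P ≈ P' → e ⊢ ν P ≈ ν P'
  unit  : ∀ {n} {P : Proc n} → e ⊢ (P ∣ 𝟎) ≈ P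
  comm  : ∀ {n} {P Q : Proc n} → e ⊢ (P ∣ Q) ≈ (Q ∣ P)
  assoc : ∀ {n} {P Q R : Proc n} → e ⊢ ((P ∣ Q) ∣ R) ≈ (P ∣ (Q ∣ R))
  sym   : ∀ {n} {P Q : Proc n} → e ⊢ P ≈ Q → e ⊢ Q ≈ P
  trans : ∀ {n} {P Q R : Proc n} → e ⊢ P ≈ Q → e ⊢ Q ≈ R → e ⊢ P ≈ R

_≡α_ : PWF → PWF → Set
(P , e) ≡α (Q , f) = (∀ x y → e x y ⇔ f x y) × (e ⊢ P ≈ Q)

{-# OPTIONS --safe #-}
-- In each *₁ step every name of ℕ¹ (an odd name) is fused with an even one, so (ν₁) binds nothing
-- and merely renames each free name to a fused even representative, which ^{-2} then halves.  The
-- classes of Φ are {2n+1, 4n+2, 4n}; hence the fusion produced by the first step relates x and y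
-- iff e ⌊x/2⌋ ⌊y/2⌋, and the one produced by the second step is exactly e·f.  Following the two
-- renamings, every free name of P and of Q is sent to an e·f-fused name, which is α-equivalence.
module Submission where

open import Defs
open import Level using (0ℓ)
open import Data.Nat using (ℕ; zero; suc; _+_; _*_; ⌊_/2⌋; parity)
open import Data.Nat.Properties using (*-suc; even≢odd)
open import Data.Parity.Base using (0ℙ; 1ℙ; _⁻¹)
open import Data.Parity.Properties using (+-homo-+; *-homo-*)
open import Data.Fin as Fin using (splitAt)
open import Data.Fin.Properties using (splitAt-↑ˡ; splitAt-↑ʳ; join-splitAt)
open import Data.Sum using (_⊎_; inj₁; inj₂)
open import Data.Product using (Σ; ∃; _×_; _,_; proj₁; proj₂)
open import Data.Empty using (⊥; ⊥-elim)
open import Function using (id; _∘_; _on_)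
open import Function.Bundles using (_⇔_; mk⇔; Equivalence)
open import Function.Construct.Composition using () renaming (equivalence to ⇔-trans)
open import Relation.Nullary using (¬_; Dec; yes; no)
open import Relation.Binary using (Rel; IsEquivalence; Reflexive; Symmetric; Transitive)
open import Relation.Binary.Construct.Closure.Transitive using (TransClosure; [_]; _∷_; _++_)
open import Relation.Binary.PropositionalEquality
  using (_≡_; _≢_; _≗_; refl; cong; cong₂; subst; subst₂; module ≡-Reasoning)
  renaming (sym to ≡-sym; trans to ≡-trans)

liftN-cong : ∀ {n m} k {ρ ρ' : Name n → Name m} → ρ ≗ ρ' → liftN k ρ ≗ liftN k ρ'
liftN-cong k ρ≗ρ' (fr a) = cong (shift k) (ρ≗ρ' (fr a))
liftN-cong {n} k ρ≗ρ' (bd i) with splitAt k {n} i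
... | inj₁ j = refl
... | inj₂ j = cong (shift k) (ρ≗ρ' (bd j))

mapN-cong : ∀ {n m} {ρ ρ' : Name n → Name m} → ρ ≗ ρ' → ∀ X → mapN ρ X ≡ mapN ρ' X
mapN-cong ρ≗ρ' 𝟎 = refl
mapN-cong ρ≗ρ' (P ∣ Q) = cong₂ _∣_ (mapN-cong ρ≗ρ' P) (mapN-cong ρ≗ρ' Q)
mapN-cong ρ≗ρ' (pre ε u k P) =
  cong₂ (λ v → pre ε v k) (ρ≗ρ' u) (mapN-cong (liftN-cong k ρ≗ρ') P)
mapN-cong ρ≗ρ' (ν P) = cong ν (mapN-cong (liftN-cong 1 ρ≗ρ') P)

liftN-shift : ∀ {n m} k (ρ : Name n → Name m) y → liftN k ρ (shift k y) ≡ shift k (ρ y)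
liftN-shift k ρ (fr a) = refl
liftN-shift {n} k ρ (bd j) rewrite splitAt-↑ʳ k n j = refl

liftN-∘ : ∀ {n m l} k (ρ : Name m → Name l) (σ : Name n → Name m) →
  liftN k ρ ∘ liftN k σ ≗ liftN k (ρ ∘ σ)
liftN-∘ k ρ σ (fr a) = liftN-shift k ρ (σ (fr a))
liftN-∘ {n} {m} k ρ σ (bd i) with splitAt k {n} i
... | inj₁ j rewrite splitAt-↑ˡ k j m = refl
... | inj₂ j = liftN-shift k ρ (σ (bd j))

mapN-∘ : ∀ {n m l} (ρ : Name m → Name l) (σ : Name n → Name m) X →
  mapN ρ (mapN σ X) ≡ mapN (ρ ∘ σ) X
mapN-∘ ρ σ 𝟎 = refl
mapN-∘ ρ σ (P ∣ Q) = cong₂ _∣_ (mapN-∘ ρ σ P) (mapN-∘ ρ σ Q)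
mapN-∘ ρ σ (pre ε u k P) = cong (pre ε (ρ (σ u)) k)
  (≡-trans (mapN-∘ (liftN k ρ) (liftN k σ) P) (mapN-cong (liftN-∘ k ρ σ) P))
mapN-∘ ρ σ (ν P) = cong ν
  (≡-trans (mapN-∘ (liftN 1 ρ) (liftN 1 σ) P) (mapN-cong (liftN-∘ 1 ρ σ) P))

liftN-fixesBound : ∀ {n} k {ρ : Name n → Name n} → ρ ∘ bd ≗ bd → liftN k ρ ∘ bd ≗ bd
liftN-fixesBound {n} k ρ-bd i with splitAt k {n} i | join-splitAt k n i
... | inj₁ j | i≡j = cong bd i≡j
... | inj₂ j | i≡j = ≡-trans (cong (shift k) (ρ-bd j)) (cong bd i≡j)

liftN-id : ∀ {n} k {ρ : Name n → Name n} → ρ ≗ id → liftN k ρ ≗ id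
liftN-id k ρ≗id (fr a) = cong (shift k) (ρ≗id (fr a))
liftN-id k ρ≗id (bd i) = liftN-fixesBound k (ρ≗id ∘ bd) i

mapN-id : ∀ {n} {ρ : Name n → Name n} → ρ ≗ id → ∀ X → mapN ρ X ≡ X
mapN-id ρ≗id 𝟎 = refl
mapN-id ρ≗id (P ∣ Q) = cong₂ _∣_ (mapN-id ρ≗id P) (mapN-id ρ≗id Q)
mapN-id ρ≗id (pre ε u k P) = cong₂ (λ v → pre ε v k) (ρ≗id u) (mapN-id (liftN-id k ρ≗id) P)
mapN-id ρ≗id (ν P) = cong ν (mapN-id (liftN-id 1 ρ≗id) P)

ren-cancel : ∀ {n} {σ σ' : ℕ → ℕ} → σ' ∘ σ ≗ id → (X : Proc n) → ren σ' (ren σ X) ≡ X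
ren-cancel {σ = σ} {σ'} σ'∘σ≗id X =
  ≡-trans (mapN-∘ (renName σ') (renName σ) X) (mapN-id cancel X)
  where
  cancel : renName σ' ∘ renName σ ≗ id
  cancel (fr a) = cong fr (σ'∘σ≗id a)
  cancel (bd j) = refl

shift-fr⁻ : ∀ {m} k {y : Name m} {a} → shift k y ≡ fr a → y ≡ fr a
shift-fr⁻ k {fr b} refl = refl

FreeIn-pre⁻ : ∀ {n a ε k} {u : Name n} {P : Proc (k + n)} →
  FreeIn a (pre ε u k P) → u ≡ fr a ⊎ FreeIn a P
FreeIn-pre⁻ subj = inj₁ refl
FreeIn-pre⁻ (body a∈P) = inj₂ a∈P

FreeIn-mapN⁺ : ∀ {n m} (ρ : Name n → Name m) X {a c} →
  FreeIn a X → ρ (fr a) ≡ fr c → FreeIn c (mapN ρ X)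
FreeIn-mapN⁺ ρ (P ∣ Q) (par-l a∈P) ρa≡c = par-l (FreeIn-mapN⁺ ρ P a∈P ρa≡c)
FreeIn-mapN⁺ ρ (P ∣ Q) (par-r a∈Q) ρa≡c = par-r (FreeIn-mapN⁺ ρ Q a∈Q ρa≡c)
FreeIn-mapN⁺ ρ (pre ε _ k P) subj ρa≡c rewrite ρa≡c = subj
FreeIn-mapN⁺ ρ (pre ε u k P) (body a∈P) ρa≡c =
  body (FreeIn-mapN⁺ (liftN k ρ) P a∈P (cong (shift k) ρa≡c))
FreeIn-mapN⁺ ρ (ν P) (res a∈P) ρa≡c =
  res (FreeIn-mapN⁺ (liftN 1 ρ) P a∈P (cong (shift 1) ρa≡c))

BoundToBound : ∀ {n m} → (Name n → Name m) → Set
BoundToBound ρ = ∀ j a → ρ (bd j) ≢ fr a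

liftN-boundToBound : ∀ {n m} k {ρ : Name n → Name m} →
  BoundToBound ρ → BoundToBound (liftN k ρ)
liftN-boundToBound {n} k {ρ} ρ-bd i a with splitAt k {n} i
... | inj₁ j = λ ()
... | inj₂ j = ρ-bd j a ∘ shift-fr⁻ k

FreeIn-mapN⁻ : ∀ {n m} {ρ : Name n → Name m} → BoundToBound ρ → ∀ X {a} →
  FreeIn a (mapN ρ X) → ∃ λ c → FreeIn c X × ρ (fr c) ≡ fr a
FreeIn-mapN⁻ ρ-bd (P ∣ Q) (par-l a∈P) with FreeIn-mapN⁻ ρ-bd P a∈P
... | c , c∈P , ρc≡a = c , par-l c∈P , ρc≡a
FreeIn-mapN⁻ ρ-bd (P ∣ Q) (par-r a∈Q) with FreeIn-mapN⁻ ρ-bd Q a∈Q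
... | c , c∈Q , ρc≡a = c , par-r c∈Q , ρc≡a
FreeIn-mapN⁻ ρ-bd (pre ε u k P) a∈X with FreeIn-pre⁻ a∈X
FreeIn-mapN⁻ ρ-bd (pre ε (fr c) k P) a∈X | inj₁ ρc≡a = c , subj , ρc≡a
FreeIn-mapN⁻ ρ-bd (pre ε (bd j) k P) a∈X | inj₁ ρj≡a = ⊥-elim (ρ-bd j _ ρj≡a)
... | inj₂ a∈P with FreeIn-mapN⁻ (liftN-boundToBound k ρ-bd) P a∈P
...   | c , c∈P , ρc≡a = c , body c∈P , shift-fr⁻ k ρc≡a
FreeIn-mapN⁻ ρ-bd (ν P) (res a∈P) with FreeIn-mapN⁻ (liftN-boundToBound 1 ρ-bd) P a∈P
... | c , c∈P , ρc≡a = c , res c∈P , shift-fr⁻ 1 ρc≡a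

FreeIn-ren⁻ : ∀ {n} σ (X : Proc n) {a} →
  FreeIn a (ren σ X) → ∃ λ c → FreeIn c X × σ c ≡ a
FreeIn-ren⁻ σ X a∈σX with FreeIn-mapN⁻ (λ _ _ ()) X a∈σX
... | c , c∈X , refl = c , c∈X , refl

NmRel-shift : ∀ {n R} k {y : Name n} {a} → NmRel R y (fr a) → NmRel R (shift k y) (fr a)
NmRel-shift k (fr r) = fr r

mapN-≈ : ∀ {n} {R : Rel ℕ 0ℓ} (ρ : Name n → Name n) → ρ ∘ bd ≗ bd → ∀ X →
  (∀ a → FreeIn a X → NmRel R (ρ (fr a)) (fr a)) → R ⊢ mapN ρ X ≈ X
mapN-≈ ρ ρ-bd 𝟎 ρ-fr = 𝟎
mapN-≈ ρ ρ-bd (P ∣ Q) ρ-fr =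
  par (mapN-≈ ρ ρ-bd P (λ a → ρ-fr a ∘ par-l)) (mapN-≈ ρ ρ-bd Q (λ a → ρ-fr a ∘ par-r))
mapN-≈ ρ ρ-bd (pre ε (fr a) k P) ρ-fr = pre (ρ-fr a subj)
  (mapN-≈ (liftN k ρ) (liftN-fixesBound k ρ-bd) P (λ b → NmRel-shift k ∘ ρ-fr b ∘ body))
mapN-≈ ρ ρ-bd (pre ε (bd j) k P) ρ-fr rewrite ρ-bd j = pre bd
  (mapN-≈ (liftN k ρ) (liftN-fixesBound k ρ-bd) P (λ b → NmRel-shift k ∘ ρ-fr b ∘ body))
mapN-≈ ρ ρ-bd (ν P) ρ-fr =
  res (mapN-≈ (liftN 1 ρ) (liftN-fixesBound 1 ρ-bd) P (λ b → NmRel-shift 1 ∘ ρ-fr b ∘ res))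

Renames : Rel ℕ 0ℓ → (Name 0 → Name 0) → Proc 0 → Set
Renames R ρ X = ∀ {a} → FreeIn a X → ∃ λ c → ρ (fr a) ≡ fr c × R a c

Renames-∘ : ∀ {R S ρ σ} X → Renames R ρ X → Renames S σ (mapN ρ X) →
  Renames (λ a c → ∃ λ b → R a b × S b c) (σ ∘ ρ) X
Renames-∘ {ρ = ρ} {σ} X ρ-ren σ-ren a∈X with ρ-ren a∈X
... | b , ρa≡b , Rab with σ-ren (FreeIn-mapN⁺ ρ X a∈X ρa≡b)
...   | c , σb≡c , Sbc = c , ≡-trans (cong σ ρa≡b) σb≡c , b , Rab , Sbc

Renames-ren : ∀ {R ρ} σ X → Renames R ρ (ren σ X) → Renames (R ∘ σ) (ρ ∘ renName σ) X
Renames-ren σ X ρ-ren a∈X = ρ-ren (FreeIn-mapN⁺ (renName σ) X a∈X refl)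

Renames-≈ : ∀ {R S ρ} X → (∀ {a c} → R a c → S c a) → Renames R ρ X → S ⊢ mapN ρ X ≈ X
Renames-≈ {ρ = ρ} X R⇒S˘ ρ-ren = mapN-≈ ρ (λ ()) X related
  where
  related : ∀ a → FreeIn a X → NmRel _ (ρ (fr a)) (fr a)
  related a a∈X with ρ-ren a∈X
  ... | c , ρa≡c , Rac rewrite ρa≡c = fr (R⇒S˘ Rac)

ι-two-suc : ∀ n → ι two (suc n) ≡ suc (suc (ι two n))
ι-two-suc = *-suc 2

⌊ι-two/2⌋ : ∀ n → ⌊ ι two n /2⌋ ≡ n
⌊ι-two/2⌋ zero = refl
⌊ι-two/2⌋ (suc n) = ≡-trans (cong ⌊_/2⌋ (ι-two-suc n)) (cong suc (⌊ι-two/2⌋ n))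

⌊ι-one/2⌋ : ∀ n → ⌊ ι one n /2⌋ ≡ n
⌊ι-one/2⌋ zero = refl
⌊ι-one/2⌋ (suc n) =
  ≡-trans (cong (⌊_/2⌋ ∘ suc) (ι-two-suc n)) (cong suc (⌊ι-one/2⌋ n))

ι-two∉ℕ¹ : ∀ n → ¬ InN one (ι two n)
ι-two∉ℕ¹ n (m , 2m+1≡2n) = even≢odd n m (≡-sym 2m+1≡2n)

ℕ²-or-ℕ¹ : ∀ a → InN two a ⊎ InN one a
ℕ²-or-ℕ¹ zero = inj₁ (0 , refl)
ℕ²-or-ℕ¹ (suc a) with ℕ²-or-ℕ¹ a
... | inj₁ (n , refl) = inj₂ (n , refl)
... | inj₂ (n , refl) = inj₁ (suc n , ι-two-suc n)

InN? : ∀ i a → Dec (InN i a)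
InN? i a with ℕ²-or-ℕ¹ a
InN? one a | inj₁ (n , refl) = no (ι-two∉ℕ¹ n)
InN? two a | inj₁ a∈ℕ² = yes a∈ℕ²
InN? one a | inj₂ a∈ℕ¹ = yes a∈ℕ¹
InN? two a | inj₂ (n , refl) = no λ (m , 2m≡2n+1) → even≢odd m n 2m≡2n+1

∉ℕ¹⇒ι-two : ∀ {a} → ¬ InN one a → ∃ λ n → a ≡ ι two n
∉ℕ¹⇒ι-two {a} a∉ℕ¹ with ℕ²-or-ℕ¹ a
... | inj₁ (n , 2n≡a) = n , ≡-sym 2n≡a
... | inj₂ a∈ℕ¹ = ⊥-elim (a∉ℕ¹ a∈ℕ¹)

parity-ι-two : ∀ n → parity (ι two n) ≡ 0ℙ
parity-ι-two = *-homo-* 2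

parity-ι-one : ∀ n → parity (ι one n) ≡ 1ℙ
parity-ι-one n = ≡-trans (+-homo-+ 1 (ι two n)) (cong _⁻¹ (parity-ι-two n))

-- The Φ-class {2n+1, 4n+2, 4n} is sent to n.
classΦ : ℕ → ℕ
classΦ u with parity u
... | 0ℙ = ⌊ ⌊ u /2⌋ /2⌋
... | 1ℙ = ⌊ u /2⌋

classΦ-one : ∀ n → classΦ (ι one n) ≡ n
classΦ-one n rewrite parity-ι-one n = ⌊ι-one/2⌋ n

classΦ-two : ∀ n → classΦ (ι two n) ≡ ⌊ n /2⌋
classΦ-two n rewrite parity-ι-two n = cong ⌊_/2⌋ (⌊ι-two/2⌋ n)

_⇔ᵣ_ : Rel ℕ 0ℓ → Rel ℕ 0ℓ → Set
R ⇔ᵣ S = ∀ x y → R x y ⇔ S x y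

⇔ᵣ-trans : ∀ {R S T} → R ⇔ᵣ S → S ⇔ᵣ T → R ⇔ᵣ T
⇔ᵣ-trans R⇔S S⇔T x y = ⇔-trans (R⇔S x y) (S⇔T x y)

on-resp-⇔ᵣ : ∀ {R S} (κ : ℕ → ℕ) → R ⇔ᵣ S → (R on κ) ⇔ᵣ (S on κ)
on-resp-⇔ᵣ κ R⇔S x y = R⇔S (κ x) (κ y)

on-cong : ∀ {R} {κ κ' : ℕ → ℕ} → κ ≗ κ' → (R on κ) ⇔ᵣ (R on κ')
on-cong {R} κ≗κ' x y =
  mk⇔ (subst₂ R (κ≗κ' x) (κ≗κ' y)) (subst₂ R (≡-sym (κ≗κ' x)) (≡-sym (κ≗κ' y)))

TransClosure-fold : ∀ {R S : Rel ℕ 0ℓ} (κ : ℕ → ℕ) → Transitive S →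
  (∀ {x y} → R x y → S (κ x) (κ y)) → ∀ {x y} → TransClosure R x y → S (κ x) (κ y)
TransClosure-fold κ S-trans R⇒S {x} {y} [ r ] = R⇒S {x} {y} r
TransClosure-fold {R} {S} κ S-trans R⇒S (_∷_ {x} {y} {z} r rs) =
  S-trans {κ x} {κ y} {κ z} (R⇒S {x} {y} r) (TransClosure-fold {R} {S} κ S-trans R⇒S rs)

·-fold : ∀ {e f S : Rel ℕ 0ℓ} (κ : ℕ → ℕ) → Transitive S →
  (∀ {x y} → e x y → S (κ x) (κ y)) → (∀ {x y} → f x y → S (κ x) (κ y)) →
  ∀ {x y} → (e · f) x y → S (κ x) (κ y)
·-fold {e} {f} {S} κ S-trans e⇒S f⇒S = TransClosure-fold {S = S} κ S-trans step
  where
  step : ∀ {x y} → e x y ⊎ f x y → S (κ x) (κ y)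
  step {x} {y} (inj₁ r) = e⇒S {x} {y} r
  step {x} {y} (inj₂ r) = f⇒S {x} {y} r

⋁-fold : ∀ {I : Set} {e : I → Rel ℕ 0ℓ} {S : Rel ℕ 0ℓ} (κ : ℕ → ℕ) → Transitive S →
  (∀ i {x y} → e i x y → S (κ x) (κ y)) → ∀ {x y} → ⋁ e x y → S (κ x) (κ y)
⋁-fold {I} {e} {S} κ S-trans e⇒S = TransClosure-fold {S = S} κ S-trans step
  where
  step : ∀ {x y} → Σ I (λ i → e i x y) → S (κ x) (κ y)
  step {x} {y} (i , r) = e⇒S i {x} {y} r

↔-fold : ∀ {a b} {κ : ℕ → ℕ} → κ a ≡ κ b → ∀ {x y} → ⟨ a ↔ b ⟩ x y → κ x ≡ κ y
↔-fold κa≡κb (inj₁ refl) = refl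
↔-fold κa≡κb (inj₂ (inj₁ (refl , refl))) = κa≡κb
↔-fold κa≡κb (inj₂ (inj₂ (refl , refl))) = ≡-sym κa≡κb

TransClosure-sym : ∀ {R : Rel ℕ 0ℓ} → Symmetric R → Symmetric (TransClosure R)
TransClosure-sym R-sym [ r ] = [ R-sym r ]
TransClosure-sym R-sym (r ∷ rs) = TransClosure-sym R-sym rs ++ [ R-sym r ]

·-sym : ∀ {e f} → Symmetric e → Symmetric f → Symmetric (e · f)
·-sym e-sym f-sym =
  TransClosure-sym λ { (inj₁ r) → inj₁ (e-sym r) ; (inj₂ r) → inj₂ (f-sym r) }

⋁-sym : ∀ {I : Set} {e : I → Rel ℕ 0ℓ} → (∀ i → Symmetric (e i)) → Symmetric (⋁ e)
⋁-sym e-sym = TransClosure-sym λ (i , r) → i , e-sym i r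

↔-sym : ∀ {a b} → Symmetric ⟨ a ↔ b ⟩
↔-sym (inj₁ refl) = inj₁ refl
↔-sym (inj₂ (inj₁ (x≡a , y≡b))) = inj₂ (inj₂ (y≡b , x≡a))
↔-sym (inj₂ (inj₂ (x≡b , y≡a))) = inj₂ (inj₁ (y≡a , x≡b))

Δ·-identityˡ : ∀ {e} → IsEquivalence e → (Δ · e) ⇔ᵣ e
Δ·-identityˡ {e} e-equiv x y =
  mk⇔ (·-fold {S = e} id e-trans (λ { refl → e-refl }) id) (λ r → [ inj₂ r ])
  where open IsEquivalence e-equiv renaming (refl to e-refl; trans to e-trans)

restrict-outside : ∀ {i R x y} → Reflexive R → ¬ InN i x → ¬ InN i y →
  restrict i R x y ⇔ R x y
restrict-outside R-refl x∉ℕⁱ y∉ℕⁱ =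
  mk⇔ (λ { (inj₁ refl) → R-refl ; (inj₂ (_ , _ , r)) → r }) (λ r → inj₂ (x∉ℕⁱ , y∉ℕⁱ , r))

·-img-on : ∀ {K E F : Rel ℕ 0ℓ} {κ : ℕ → ℕ} → Reflexive E → κ ∘ ι one ≗ id →
  K ⇔ᵣ (E on κ) → (K · img one F) ⇔ᵣ ((E · F) on κ)
·-img-on {K} {E} {F} {κ} E-refl κ-ι-one K⇔E u v =
  mk⇔ (·-fold {S = E · F} κ _++_ K-step img-step) (from refl refl)
  where
  K-step : ∀ {x y} → K x y → (E · F) (κ x) (κ y)
  K-step {x} {y} k = [ inj₁ (Equivalence.to (K⇔E x y) k) ]
  img-step : ∀ {x y} → img one F x y → (E · F) (κ x) (κ y)
  img-step (inj₁ refl) = [ inj₁ E-refl ]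
  img-step (inj₂ (a , b , refl , refl , r)) rewrite κ-ι-one a | κ-ι-one b = [ inj₂ r ]
  K-from : ∀ {x y a b} → κ x ≡ a → κ y ≡ b → E a b → K x y
  K-from {x} {y} refl refl = Equivalence.from (K⇔E x y)
  -- an F-step between classes a and b is realised by the odd names ι one a and ι one b
  step : ∀ {x y a b} → κ x ≡ a → κ y ≡ b → E a b ⊎ F a b → (K · img one F) x y
  step κx≡a κy≡b (inj₁ r) = [ inj₁ (K-from κx≡a κy≡b r) ]
  step {a = a} {b} κx≡a κy≡b (inj₂ r) =
    inj₁ (K-from κx≡a (κ-ι-one a) E-refl) ∷
    inj₂ (inj₂ (a , b , refl , refl , r)) ∷
    [ inj₁ (K-from (κ-ι-one b) κy≡b E-refl) ]
  from : ∀ {x y a b} → κ x ≡ a → κ y ≡ b → (E · F) a b → (K · img one F) x y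
  from κx≡a κy≡b [ s ] = step κx≡a κy≡b s
  from κx≡a κy≡b (_∷_ {y = c} s ss) = step κx≡a (κ-ι-one c) s ++ from (κ-ι-one c) κy≡b ss

Φ-preserves-classΦ : ∀ {x y} → Φ x y → classΦ x ≡ classΦ y
Φ-preserves-classΦ = ·-fold {S = _≡_} classΦ ≡-trans
  (⋁-fold {S = _≡_} classΦ ≡-trans λ n →
    ↔-fold (≡-trans (classΦ-one n) (≡-sym (classΦ-two-one n))))
  (⋁-fold {S = _≡_} classΦ ≡-trans λ n →
    ↔-fold (≡-trans (classΦ-two-one n) (≡-sym (classΦ-two-two n))))
  where
  classΦ-two-one : ∀ n → classΦ (ι two (ι one n)) ≡ n
  classΦ-two-one n = ≡-trans (classΦ-two (ι one n)) (⌊ι-one/2⌋ n)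
  classΦ-two-two : ∀ n → classΦ (ι two (ι two n)) ≡ n
  classΦ-two-two n = ≡-trans (classΦ-two (ι two n)) (⌊ι-two/2⌋ n)

Φ-sym : Symmetric Φ
Φ-sym = ·-sym (⋁-sym λ _ → ↔-sym) (⋁-sym λ _ → ↔-sym)

Φ-toℕ¹ : ∀ u → Φ u (ι one (classΦ u))
Φ-toℕ¹ u with ℕ²-or-ℕ¹ u
... | inj₂ (n , refl) rewrite classΦ-one n = [ inj₁ [ 0 , inj₁ refl ] ]
... | inj₁ (m , refl) with ℕ²-or-ℕ¹ m
...   | inj₂ (n , refl) rewrite classΦ-two (ι one n) | ⌊ι-one/2⌋ n =
  [ inj₁ [ n , inj₂ (inj₂ (refl , refl)) ] ]
...   | inj₁ (n , refl) rewrite classΦ-two (ι two n) | ⌊ι-two/2⌋ n =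
  inj₂ [ n , inj₂ (inj₂ (refl , refl)) ] ∷ [ inj₁ [ n , inj₂ (inj₂ (refl , refl)) ] ]

Φ⇔classΦ : Φ ⇔ᵣ (_≡_ on classΦ)
Φ⇔classΦ u v = mk⇔ Φ-preserves-classΦ λ same →
  Φ-toℕ¹ u ++ subst (λ c → Φ (ι one c) v) (≡-sym same) (Φ-sym (Φ-toℕ¹ v))

*₁-fusion : Rel ℕ 0ℓ → Rel ℕ 0ℓ → Rel ℕ 0ℓ
*₁-fusion e f = restrict one (e · img one f) on ι two

*₁-fusion⇔ : ∀ {K F S} → (K · img one F) ⇔ᵣ S → *₁-fusion K F ⇔ᵣ (S on ι two)
*₁-fusion⇔ {K} {F} K·F⇔S x y = ⇔-trans
  (restrict-outside {one} {K · img one F} [ inj₂ (inj₁ refl) ] (ι-two∉ℕ¹ x) (ι-two∉ℕ¹ y))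
  (K·F⇔S (ι two x) (ι two y))

Φ·img⇔ : ∀ {e} → IsEquivalence e → (Φ · img one e) ⇔ᵣ (e on classΦ)
Φ·img⇔ e-equiv =
  ⇔ᵣ-trans (·-img-on refl classΦ-one Φ⇔classΦ) (on-resp-⇔ᵣ classΦ (Δ·-identityˡ e-equiv))

Φ*₁-fusion⇔ : ∀ {e} → IsEquivalence e → *₁-fusion Φ e ⇔ᵣ (e on ⌊_/2⌋)
Φ*₁-fusion⇔ {e} e-equiv = ⇔ᵣ-trans (*₁-fusion⇔ (Φ·img⇔ e-equiv)) (on-cong {e} classΦ-two)

Φ*₁·img⇔ : ∀ {e f} → IsEquivalence e →
  (*₁-fusion Φ e · img one f) ⇔ᵣ ((e · f) on ⌊_/2⌋)
Φ*₁·img⇔ e-equiv = ·-img-on (IsEquivalence.refl e-equiv) ⌊ι-one/2⌋ (Φ*₁-fusion⇔ e-equiv)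

Φ*₁*₁-fusion⇔ : ∀ {e f} → IsEquivalence e → *₁-fusion (*₁-fusion Φ e) f ⇔ᵣ (e · f)
Φ*₁*₁-fusion⇔ {e} {f} e-equiv =
  ⇔ᵣ-trans (*₁-fusion⇔ (Φ*₁·img⇔ e-equiv)) (on-cong {e · f} ⌊ι-two/2⌋)

NuData-noBound : ∀ {i G X k τ} → NuData i G X (suc k) τ →
  (∀ a → FreeIn a X → InN i a → ∃ λ b → ¬ InN i b × G a b) → ⊥
NuData-noBound {i} nd reps with NuData.used nd Fin.zero
... | a , a∈X , τa≡0 with InN? i a
...   | yes a∈ℕⁱ = let b , b∉ℕⁱ , Gab = reps a a∈X a∈ℕⁱ in
  b∉ℕⁱ (NuData.noRepr nd a Fin.zero a∈X a∈ℕⁱ τa≡0 b Gab)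
...   | no a∉ℕⁱ with ≡-trans (≡-sym (NuData.outside nd a a∈X a∉ℕⁱ)) τa≡0
...     | ()

NuData-fr : ∀ {i G X k τ a b} → NuData i G X k τ → Reflexive G →
  FreeIn a X → τ a ≡ fr b → ¬ InN i b × G a b
NuData-fr {i} {a = a} {b} nd G-refl a∈X τa≡b with InN? i a
... | yes a∈ℕⁱ = NuData.repr nd a b a∈X a∈ℕⁱ τa≡b
... | no a∉ℕⁱ with ≡-trans (≡-sym (NuData.outside nd a a∈X a∉ℕⁱ)) τa≡b
...   | refl = a∉ℕⁱ , G-refl

ℕ¹FusedToℕ² : Rel ℕ 0ℓ → Set
ℕ¹FusedToℕ² G = ∀ n → ∃ λ b → G (ι one n) (ι two b)

Star₁-renaming : ∀ {X e₀ Y f₀ C} → ℕ¹FusedToℕ² (e₀ · img one f₀) →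
  Star₁ (X , e₀) (Y , f₀) C →
  ∃ λ ρ → C ≡ (mapN ρ (X ∣ ren (ι one) Y) , *₁-fusion e₀ f₀) ×
          Renames (λ a c → (e₀ · img one f₀) a (ι two c)) ρ (X ∣ ren (ι one) Y)
Star₁-renaming {X} {e₀} {Y} {f₀} fused (_ , (suc k , τ , nd , refl) , _) =
  ⊥-elim (NuData-noBound nd representative)
  where
  representative : ∀ a → FreeIn a (X ∣ ren (ι one) Y) → InN one a →
    ∃ λ b → ¬ InN one b × (e₀ · img one f₀) a b
  representative a _ (n , refl) = let b , Gab = fused n in ι two b , ι-two∉ℕ¹ b , Gab
Star₁-renaming {X} {e₀} {Y} {f₀} fused (_ , (zero , τ , nd , refl) , (P' , ren₂P'≡ , refl)) =
  renName ⌊_/2⌋ ∘ close τ , cong (_, *₁-fusion e₀ f₀) P'≡ , renames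
  where
  Z : Proc 0
  Z = X ∣ ren (ι one) Y
  P'≡ : P' ≡ mapN (renName ⌊_/2⌋ ∘ close τ) Z
  P'≡ = begin
    P'                               ≡⟨ ren-cancel ⌊ι-two/2⌋ P' ⟨
    ren ⌊_/2⌋ (ren (ι two) P')       ≡⟨ cong (ren ⌊_/2⌋) ren₂P'≡ ⟩
    ren ⌊_/2⌋ (mapN (close τ) Z)     ≡⟨ mapN-∘ (renName ⌊_/2⌋) (close τ) Z ⟩
    mapN (renName ⌊_/2⌋ ∘ close τ) Z ∎
    where open ≡-Reasoning
  renames : Renames (λ a c → (e₀ · img one f₀) a (ι two c)) (renName ⌊_/2⌋ ∘ close τ) Z
  renames {a} a∈Z with τ a in τa≡
  ... | fr b with NuData-fr nd [ inj₂ (inj₁ refl) ] a∈Z τa≡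
  ...   | b∉ℕ¹ , Gab with ∉ℕ¹⇒ι-two b∉ℕ¹
  ...     | c , refl = c , cong fr (⌊ι-two/2⌋ c) , Gab

Star₁-intro : ∀ {X e₀ Y f₀} → (∀ {a} → FreeIn a X → InN one a) →
  (fused : ℕ¹FusedToℕ² (e₀ · img one f₀)) →
  Star₁ (X , e₀) (Y , f₀) (ren (proj₁ ∘ fused ∘ ⌊_/2⌋) (X ∣ ren (ι one) Y) , *₁-fusion e₀ f₀)
Star₁-intro {X} {e₀} {Y} {f₀} X⊆ℕ¹ fused = _ , (0 , τ , nuData , refl) , (_ , image , refl)
  where
  Z : Proc 0
  Z = X ∣ ren (ι one) Y
  σ : ℕ → ℕ
  σ = proj₁ ∘ fused ∘ ⌊_/2⌋
  τ : ℕ → Name 0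
  τ a = fr (ι two (σ a))
  Z⊆ℕ¹ : ∀ {a} → FreeIn a Z → InN one a
  Z⊆ℕ¹ (par-l a∈X) = X⊆ℕ¹ a∈X
  Z⊆ℕ¹ (par-r a∈Y¹) = let c , _ , ι₁c≡a = FreeIn-ren⁻ (ι one) Y a∈Y¹ in c , ι₁c≡a
  representative : ∀ a b → FreeIn a Z → InN one a → τ a ≡ fr b →
    ¬ InN one b × (e₀ · img one f₀) a b
  representative _ _ _ (n , refl) refl rewrite ⌊ι-one/2⌋ n =
    ι-two∉ℕ¹ (proj₁ (fused n)) , proj₂ (fused n)
  nuData : NuData one (e₀ · img one f₀) Z 0 τ
  nuData = record
    { outside = λ a a∈Z a∉ℕ¹ → ⊥-elim (a∉ℕ¹ (Z⊆ℕ¹ a∈Z))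
    ; repr    = representative
    ; noRepr  = λ _ _ _ _ ()
    ; sameBd  = λ _ _ _ _ _ _ _ _ ()
    ; used    = λ () }
  image : ren (ι two) (ren σ Z) ≡ mapN (close τ) Z
  image = ≡-trans (mapN-∘ (renName (ι two)) (renName σ) Z)
                  (mapN-cong (λ { (fr a) → refl ; (bd ()) }) Z)

Φ·img-fused : ∀ {e} → ℕ¹FusedToℕ² (Φ · img one e)
Φ·img-fused n = ι one n , [ inj₁ [ inj₁ [ n , inj₂ (inj₁ (refl , refl)) ] ] ]

module _ {e f : Rel ℕ 0ℓ} (e-equiv : IsEquivalence e) where

  open IsEquivalence e-equiv using () renaming (refl to e-refl; sym to e-sym)

  Φ*₁·img-fused : ℕ¹FusedToℕ² (*₁-fusion Φ e · img one f)
  Φ*₁·img-fused n = n , Equivalence.from (Φ*₁·img⇔ e-equiv (ι one n) (ι two n))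
    (subst₂ (e · f) (≡-sym (⌊ι-one/2⌋ n)) (≡-sym (⌊ι-two/2⌋ n)) [ inj₁ e-refl ])

  Φ*₁*₁-defined : ∀ P Q →
    Σ PWF λ C₁ → Σ PWF λ C₂ → Star₁ (fus Φ) (P , e) C₁ × Star₁ C₁ (Q , f) C₂
  Φ*₁*₁-defined P Q = _ , _ , Star₁-intro (λ ()) Φ·img-fused , Star₁-intro C₁⊆ℕ¹ Φ*₁·img-fused
    where
    C₁⊆ℕ¹ : ∀ {a} → FreeIn a (ren (proj₁ ∘ Φ·img-fused {e} ∘ ⌊_/2⌋) (𝟎 ∣ ren (ι one) P)) →
      InN one a
    C₁⊆ℕ¹ a∈C₁ = let c , _ , σc≡a = FreeIn-ren⁻ _ _ a∈C₁ in ⌊ c /2⌋ , σc≡a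

  Φ·img-to : ∀ {a b} → (Φ · img one e) (ι one a) (ι two b) → e a ⌊ b /2⌋
  Φ·img-to {a} {b} =
    subst₂ e (classΦ-one a) (classΦ-two b) ∘ Equivalence.to (Φ·img⇔ e-equiv _ _)

  Φ*₁·img-to : ∀ {b c} → (*₁-fusion Φ e · img one f) b (ι two c) → (e · f) ⌊ b /2⌋ c
  Φ*₁·img-to {b} {c} =
    subst ((e · f) ⌊ b /2⌋) (⌊ι-two/2⌋ c) ∘ Equivalence.to (Φ*₁·img⇔ e-equiv _ _)

  module _ (f-sym : Symmetric f) where

    Φ*₁*₁-fusion-from˘ : ∀ {a c} → (e · f) a c → *₁-fusion (*₁-fusion Φ e) f c a
    Φ*₁*₁-fusion-from˘ = Equivalence.from (Φ*₁*₁-fusion⇔ e-equiv _ _) ∘ ·-sym e-sym f-sym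

    Φ*₁*₁-≡α : ∀ P Q C₁ C₂ → Star₁ (fus Φ) (P , e) C₁ → Star₁ C₁ (Q , f) C₂ →
      C₂ ≡α ((P , e) ∥ (Q , f))
    Φ*₁*₁-≡α P Q C₁ C₂ s₁ s₂ with Star₁-renaming Φ·img-fused s₁
    ... | ρ₁ , refl , renames₁ with Star₁-renaming Φ*₁·img-fused s₂
    ...   | ρ₂ , refl , renames₂ =
      Φ*₁*₁-fusion⇔ e-equiv , par (trans comm (trans unit P-part)) Q-part
      where
      P-renamed : Renames (λ a c → ∃ λ b → (Φ · img one e) (ι one a) (ι two b) ×
                                            (*₁-fusion Φ e · img one f) b (ι two c))
                          (ρ₂ ∘ ρ₁ ∘ renName (ι one)) P
      P-renamed = Renames-ren {ρ = ρ₂ ∘ ρ₁} (ι one) P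
        (Renames-∘ {ρ = ρ₁} {ρ₂} (ren (ι one) P)
          (λ a∈ → renames₁ (par-r a∈)) (λ a∈ → renames₂ (par-l (par-r a∈))))
      P-part : *₁-fusion (*₁-fusion Φ e) f ⊢ mapN ρ₂ (mapN ρ₁ (ren (ι one) P)) ≈ P
      P-part = subst (λ X → _ ⊢ X ≈ P)
        (≡-sym (≡-trans (mapN-∘ ρ₂ ρ₁ (ren (ι one) P)) (mapN-∘ (ρ₂ ∘ ρ₁) (renName (ι one)) P)))
        (Renames-≈ P (λ {a} {c} (b , Gab , Gbc) → Φ*₁*₁-fusion-from˘
          ([ inj₁ (Φ·img-to {a} {b} Gab) ] ++ Φ*₁·img-to {b} {c} Gbc)) P-renamed)
      Q-part : *₁-fusion (*₁-fusion Φ e) f ⊢ mapN ρ₂ (ren (ι one) Q) ≈ Q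
      Q-part = subst (λ X → _ ⊢ X ≈ Q) (≡-sym (mapN-∘ ρ₂ (renName (ι one)) Q))
        (Renames-≈ Q (λ {a} {c} Gac → Φ*₁*₁-fusion-from˘
          (subst (λ x → (e · f) x c) (⌊ι-one/2⌋ a) (Φ*₁·img-to Gac)))
          (Renames-ren {ρ = ρ₂} (ι one) Q (λ a∈ → renames₂ (par-r a∈))))

proposition2p33 : (P Q : Proc 0) (e f : Rel ℕ 0ℓ) → IsFusion e → IsFusion f →
    (Σ PWF λ C₁ → Σ PWF λ C₂ → Star₁ (fus Φ) (P , e) C₁ × Star₁ C₁ (Q , f) C₂) ×
    (∀ C₁ C₂ → Star₁ (fus Φ) (P , e) C₁ → Star₁ C₁ (Q , f) C₂ → C₂ ≡α ((P , e) ∥ (Q , f)))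
proposition2p33 P Q e f eF fF =
  Φ*₁*₁-defined e-equiv P Q , Φ*₁*₁-≡α e-equiv (IsEquivalence.sym (IsFusion.isEquivalence fF)) P Q
  where
  e-equiv : IsEquivalence e
  e-equiv = IsFusion.isEquivalence eF
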